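{- Let $n\ge 1$ be an integer and let $L(n)=(L(n)_1,\dots,L(n)_{n-1})$. Consider the directed graph $G=(V,E)$ with $V=\{1,2,\dots,n-1\}$ and $E=\{(i,L(n)_i):1<i<n\}$. Then $G$ is a directed path through all vertices: the vertices can be listed as $v_1,\dots,v_{n-1}$ (each exactly once) so that $E=\{(v_j,v_{j+1}):1\le j<n-1\}$.
   Context: For an integer $n\ge1$, $L(n)$ is the sequence of length $n-1$ listing the elements of $\{1,2,\dots,n\}\setminus\{\lceil n/2\rceil\}$ in decreasing order, i.e. $L(n)=(n,n-1,\dots,\lceil n/2\rceil+1,\lceil n/2\rceil-1,\dots,2,1)$. -}

module Defs where

open import Data.Nat using (ℕ; zero; suc; _<_; ⌈_/2⌉; _≟_)
open import Data.List using (List; []; _∷_; filter)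
open import Data.Maybe using (Maybe; just; nothing)
open import Data.Product using (_×_)
open import Relation.Binary.PropositionalEquality using (_≡_)
open import Relation.Nullary using (¬?)

descending : ℕ → List ℕ
descending zero    = []
descending (suc k) = suc k ∷ descending k

L : ℕ → List ℕ
L n = filter (λ x → ¬? (x ≟ ⌈ n /2⌉)) (descending n)

at : {A : Set} → List A → ℕ → Maybe A
at []       _       = nothing
at (x ∷ xs) zero    = just x
at (x ∷ xs) (suc k) = at xs k

-- 1-indexed entry L(n)_i (for 1 ≤ i ≤ n-1); entry n 0 is unused
entry : ℕ → ℕ → Maybe ℕ
entry n zero    = nothing
entry n (suc k) = at (L n) k

Edge : ℕ → ℕ → ℕ → Set
Edge n i j = (1 < i) × (i < n) × (entry n i ≡ just j)

-- Let h = ⌊n/2⌋, the number of entries of L(n) above the removed ⌈n/2⌉.  Then L(n)_i is n+1-i for i ≤ h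
-- and n-i for i > h, so every edge joins a vertex ≤ h to one > h, and following the edges from the middle
-- zigzags outwards: for odd n = 2h+1 the path is h+1, h, h+2, h-1, ..., 2h, 1, and for even n = 2h it is
-- h, h+1, h-1, h+2, ..., 2h-1, 1.  It ends at 1, the one vertex without an outgoing edge.
module Submission where

open import Defs
open import Data.Nat using (ℕ; zero; suc; _≤_; _<_; _∸_; _+_; s≤s; z<s; _≟_; _<?_; _≤?_; ⌊_/2⌋; ⌈_/2⌉)
open import Data.Nat.Properties
open import Data.Nat.Tactic.RingSolver using (solve-∀)
open import Data.List using (List; []; _∷_; filter)
open import Data.List.Properties using (filter-accept; filter-reject; filter-all)
open import Data.List.Membership.Propositional using (_∈_)
open import Data.List.Relation.Unary.Any using (here; there)
open import Data.List.Relation.Unary.All using (All; []; _∷_; tabulate)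
open import Data.List.Relation.Unary.Unique.Propositional using (Unique)
open import Data.List.Relation.Unary.AllPairs using ([]; _∷_)
open import Data.Product using (_×_; ∃-syntax; _,_; proj₂)
open import Data.Sum using (_⊎_; inj₁; inj₂)
import Data.Sum as Sum
open import Data.Empty using (⊥-elim)
open import Data.Maybe using (just)
open import Data.Maybe.Properties using (just-injective)
open import Function using (_∘_)
open import Function.Bundles using (_⇔_; mk⇔; Equivalence)
open import Function.Properties.Equivalence using () renaming (sym to ⇔-sym; trans to ⇔-trans)
open import Relation.Binary.PropositionalEquality using (_≡_; _≢_; refl; sym; trans; cong; subst)
open import Relation.Nullary using (¬?; yes; no)

-- j = L(n)_i, with h = ⌊n/2⌋, stated additively to avoid truncated subtraction.
Step : ℕ → ℕ → ℕ → ℕ → Set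
Step h n i j = (i ≤ h × i + j ≡ suc n) ⊎ (h < i × i + j ≡ n)

Step-functional : ∀ {h n i j j′} → Step h n i j → Step h n i j′ → j ≡ j′
Step-functional {i = i} (inj₁ (_ , e)) (inj₁ (_ , e′)) = +-cancelˡ-≡ i _ _ (trans e (sym e′))
Step-functional (inj₁ (i≤h , _)) (inj₂ (h<i , _)) = ⊥-elim (<⇒≱ h<i i≤h)
Step-functional (inj₂ (h<i , _)) (inj₁ (i≤h , _)) = ⊥-elim (<⇒≱ h<i i≤h)
Step-functional {i = i} (inj₂ (_ , e)) (inj₂ (_ , e′)) = +-cancelˡ-≡ i _ _ (trans e (sym e′))

dropping : ℕ → List ℕ → List ℕ
dropping m = filter (λ x → ¬? (x ≟ m))

dropping-∷ : ∀ {m x} xs → x ≢ m → dropping m (x ∷ xs) ≡ x ∷ dropping m xs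
dropping-∷ {m} _ = filter-accept (λ y → ¬? (y ≟ m))

dropping-descending-< : ∀ {m} d → d < m → dropping m (descending d) ≡ descending d
dropping-descending-< {m} d d<m = filter-all (λ x → ¬? (x ≟ m)) (all-≢ d d<m)
  where
  all-≢ : ∀ d → d < m → All (_≢ m) (descending d)
  all-≢ zero    _   = []
  all-≢ (suc d) d<m = (λ d≡m → <-irrefl d≡m d<m) ∷ all-≢ d (<-trans (n<1+n d) d<m)

dropping-descending-self : ∀ d → dropping (suc d) (descending (suc d)) ≡ descending d
dropping-descending-self d =
  trans (filter-reject (λ x → ¬? (x ≟ suc d)) (λ ≢ → ≢ refl)) (dropping-descending-< d (n<1+n d))

suc[t+m]≢m : ∀ t m → suc (t + m) ≢ m
suc[t+m]≢m t m e = <-irrefl (sym e) (s≤s (m≤n+m m t))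

at-descending : ∀ k j → at (descending (suc k + j)) k ≡ just (suc j)
at-descending zero    j = refl
at-descending (suc k) j = at-descending k j

at-dropping-descending-above : ∀ k r m → at (dropping m (descending (suc k + r + m))) k ≡ just (suc r + m)
at-dropping-descending-above zero r m
  rewrite dropping-∷ (descending (r + m)) (suc[t+m]≢m r m) = refl
at-dropping-descending-above (suc k) r m
  rewrite dropping-∷ (descending (suc k + r + m)) (suc[t+m]≢m (suc k + r) m) = at-dropping-descending-above k r m

at-dropping-descending-below : ∀ t m k → at (dropping (suc m) (descending (t + suc m))) (t + k) ≡ at (descending m) k
at-dropping-descending-below zero m k rewrite dropping-descending-self m = refl
at-dropping-descending-below (suc t) m k
  rewrite dropping-∷ (descending (t + suc m)) (suc[t+m]≢m t (suc m)) = at-dropping-descending-below t m k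

suc[h+t]<h+suc[m]⇒t<m : ∀ h t m → suc (h + t) < h + suc m → t < m
suc[h+t]<h+suc[m]⇒t<m h t m lt = ≤-pred (+-cancelˡ-< h (suc t) (suc m) (subst (_< h + suc m) (sym (+-suc h t)) lt))

at-dropping-descending-Step : ∀ h m k → suc k < h + suc m →
  ∃[ j ] (at (dropping (suc m) (descending (h + suc m))) k ≡ just j × Step h (h + suc m) (suc k) j)
at-dropping-descending-Step h m k k<n with k <? h
... | yes k<h with m≤n⇒∃[o]m+o≡n k<h
...   | r , refl = suc r + suc m , at-dropping-descending-above k r (suc m) , inj₁ (m≤m+n (suc k) r , sum k r m)
  where
  sum : ∀ k r m → suc k + (suc r + suc m) ≡ suc (suc k + r + suc m)
  sum = solve-∀
at-dropping-descending-Step h m k k<n | no k≮h with m≤n⇒∃[o]m+o≡n (≮⇒≥ k≮h)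
... | t , refl with m≤n⇒∃[o]m+o≡n (suc[h+t]<h+suc[m]⇒t<m h t m k<n)
...   | j , refl = suc j
                 , trans (at-dropping-descending-below h (suc t + j) t) (at-descending t j)
                 , inj₂ (s≤s (m≤m+n h t) , sum h t j)
  where
  sum : ∀ h t j → suc (h + t) + suc j ≡ h + suc (suc t + j)
  sum = solve-∀

Edge⇔Step : ∀ {n h m i j} → n ≡ h + suc m → ⌈ n /2⌉ ≡ suc m →
  Edge n i j ⇔ (1 < i × i < n × Step h n i j)
Edge⇔Step {n} {h} {m} {i} {j} refl ⌈n/2⌉≡ = mk⇔ edge⇒step step⇒edge
  where
  entry-Step : ∀ k → suc k < n → ∃[ j ] (entry n (suc k) ≡ just j × Step h n (suc k) j)
  entry-Step k k<n = subst (λ c → ∃[ j ] (at (dropping c (descending n)) k ≡ just j × Step h n (suc k) j))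
                           (sym ⌈n/2⌉≡) (at-dropping-descending-Step h m k k<n)
  edge⇒step : Edge n i j → 1 < i × i < n × Step h n i j
  edge⇒step (1<i@(s≤s _) , i<n , e) with entry-Step _ i<n
  ... | j′ , e′ , s rewrite just-injective (trans (sym e) e′) = 1<i , i<n , s
  step⇒edge : 1 < i × i < n × Step h n i j → Edge n i j
  step⇒edge (1<i@(s≤s _) , i<n , s) with entry-Step _ i<n
  ... | j′ , e′ , s′ rewrite Step-functional s′ s = 1<i , i<n , e′

Adjacent : List ℕ → ℕ → ℕ → Set
Adjacent vs i j = ∃[ k ] (at vs k ≡ just i × at vs (suc k) ≡ just j)

at⇒∈ : ∀ {A : Set} {x : A} xs k → at xs k ≡ just x → x ∈ xs
at⇒∈ (y ∷ ys) zero    refl = here refl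
at⇒∈ (y ∷ ys) (suc k) e    = there (at⇒∈ ys k e)

zigzag : ℕ → ℕ → List ℕ
zigzag a zero    = []
zigzag a (suc b) = a ∷ suc b ∷ zigzag (suc a) b

at-zigzag-head : ∀ a b {j} → at (zigzag a b) 0 ≡ just j ⇔ (1 ≤ b × a ≡ j)
at-zigzag-head a zero    = mk⇔ (λ ()) (λ { (() , _) })
at-zigzag-head a (suc b) = mk⇔ (λ { refl → z<s , refl }) (λ { (_ , refl) → refl })

∈-zigzag⁻ : ∀ a b {v} → v ∈ zigzag a b → (1 ≤ v × v ≤ b) ⊎ (a ≤ v × v < a + b)
∈-zigzag⁻ a (suc b) (here refl)         = inj₂ (≤-refl , m<m+n a z<s)
∈-zigzag⁻ a (suc b) (there (here refl)) = inj₁ (z<s , ≤-refl)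
∈-zigzag⁻ a (suc b) {v} (there (there p)) with ∈-zigzag⁻ (suc a) b p
... | inj₁ (1≤v , v≤b)   = inj₁ (1≤v , m≤n⇒m≤1+n v≤b)
... | inj₂ (a<v , v<a+b) = inj₂ (<⇒≤ a<v , subst (v <_) (sym (+-suc a b)) v<a+b)

∈-zigzag⁺ : ∀ a b {v} → (1 ≤ v × v ≤ b) ⊎ (a ≤ v × v < a + b) → v ∈ zigzag a b
∈-zigzag⁺ a zero (inj₁ (1≤v , v≤0))    = ⊥-elim (<⇒≱ 1≤v v≤0)
∈-zigzag⁺ a zero {v} (inj₂ (a≤v , v<a+0))  = ⊥-elim (<⇒≱ (subst (v <_) (+-identityʳ a) v<a+0) a≤v)
∈-zigzag⁺ a (suc b) {v} (inj₁ (1≤v , v≤b)) with v ≟ suc b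
... | yes refl = there (here refl)
... | no v≢b   = there (there (∈-zigzag⁺ (suc a) b (inj₁ (1≤v , ≤-pred (≤∧≢⇒< v≤b v≢b)))))
∈-zigzag⁺ a (suc b) {v} (inj₂ (a≤v , v<a+b)) with a ≟ v
... | yes refl = here refl
... | no a≢v   =
  there (there (∈-zigzag⁺ (suc a) b (inj₂ (≤∧≢⇒< a≤v a≢v , subst (v <_) (+-suc a b) v<a+b))))

zigzag-unique : ∀ a b → b < a → Unique (zigzag a b)
zigzag-unique a zero    _   = []
zigzag-unique a (suc b) 1+b<a =
  (>⇒≢ 1+b<a ∷ tabulate (a∉ ∘ ∈-zigzag⁻ (suc a) b)) ∷ tabulate (b∉ ∘ ∈-zigzag⁻ (suc a) b)
  ∷ zigzag-unique (suc a) b (m<n⇒m<1+n (<-trans (n<1+n b) 1+b<a))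
  where
  a∉ : ∀ {v} → (1 ≤ v × v ≤ b) ⊎ (suc a ≤ v × v < suc a + b) → a ≢ v
  a∉ (inj₁ (_ , v≤b)) refl = <⇒≱ 1+b<a (m≤n⇒m≤1+n v≤b)
  a∉ (inj₂ (a<v , _)) refl = <-irrefl refl a<v
  b∉ : ∀ {v} → (1 ≤ v × v ≤ b) ⊎ (suc a ≤ v × v < suc a + b) → suc b ≢ v
  b∉ (inj₁ (_ , v≤b)) refl = <-irrefl refl v≤b
  b∉ (inj₂ (a<v , _)) refl = <⇒≱ 1+b<a (<⇒≤ a<v)

-- The two runs of zigzag a b lie on either side of h and pair up to n, so each step of the list is a Step.
Straddles : ℕ → ℕ → ℕ → ℕ → Set
Straddles h n a b = a + b ≡ n × b ≤ h × h < a

straddles-next : ∀ {h n a b} → Straddles h n a (suc b) → Straddles h n (suc a) b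
straddles-next {a = a} {b} (sum , b<h , h<a) = trans (sym (+-suc a b)) sum , <⇒≤ b<h , m<n⇒m<1+n h<a

straddles-1<a : ∀ {h n a b} → Straddles h n a (suc b) → 1 < a
straddles-1<a (_ , b<h , h<a) = ≤-<-trans (≤-trans z<s b<h) h<a

zigzag-Step₁ : ∀ {h n a b} → Straddles h n a (suc b) → Step h n a (suc b)
zigzag-Step₁ (sum , _ , h<a) = inj₂ (h<a , sum)

zigzag-Step₂ : ∀ {h n a b} → Straddles h n a (suc b) → Step h n (suc b) (suc a)
zigzag-Step₂ {a = a} {b} (sum , b<h , _) = inj₁ (b<h , trans (swap a b) (cong suc sum))
  where
  swap : ∀ a b → suc b + suc a ≡ suc (a + suc b)
  swap = solve-∀

zigzag-Adjacent⇒ : ∀ {h n} a b {i j} k → Straddles h n a b →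
  at (zigzag a b) k ≡ just i → at (zigzag a b) (suc k) ≡ just j → 1 < i × Step h n i j
zigzag-Adjacent⇒ a (suc b)       zero          st refl refl = straddles-1<a st , zigzag-Step₁ st
zigzag-Adjacent⇒ a (suc (suc b)) (suc zero)    st refl refl = s≤s z<s , zigzag-Step₂ st
zigzag-Adjacent⇒ a (suc b)       (suc (suc k)) st p    q    = zigzag-Adjacent⇒ (suc a) b k (straddles-next st) p q

zigzag-Adjacent⇐ : ∀ {h n} a b {i j} → Straddles h n a b →
  i ∈ zigzag a b → 1 < i → Step h n i j → Adjacent (zigzag a b) i j
zigzag-Adjacent⇐ a (suc b) st (here refl) _ s = 0 , refl , cong just (Step-functional (zigzag-Step₁ st) s)
zigzag-Adjacent⇐ a (suc (suc b)) st (there (here refl)) _ s =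
  1 , refl , cong just (Step-functional (zigzag-Step₂ st) s)
zigzag-Adjacent⇐ a (suc zero) st (there (here refl)) (s≤s ()) s
zigzag-Adjacent⇐ a (suc b) st (there (there p)) 1<i s with zigzag-Adjacent⇐ (suc a) b (straddles-next st) p 1<i s
... | k , p′ , q′ = suc (suc k) , p′ , q′

zigzag-Adjacent : ∀ {h n} a b {i j} → Straddles h n a b →
  Adjacent (zigzag a b) i j ⇔ (i ∈ zigzag a b × 1 < i × Step h n i j)
zigzag-Adjacent a b st = mk⇔
  (λ (k , p , q) → let 1<i , s = zigzag-Adjacent⇒ a b k st p q in at⇒∈ (zigzag a b) k p , 1<i , s)
  (λ (i∈ , 1<i , s) → zigzag-Adjacent⇐ a b st i∈ 1<i s)

StepPath : ℕ → ℕ → List ℕ → Set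
StepPath h n vs = Unique vs
  × (∀ v → v ∈ vs ⇔ (1 ≤ v × v < n))
  × (∀ i j → Adjacent vs i j ⇔ (i ∈ vs × 1 < i × Step h n i j))

odd-StepPath : ∀ h → StepPath h (h + suc h) (zigzag (suc h) h)
odd-StepPath h = zigzag-unique (suc h) h ≤-refl , members , λ _ _ → zigzag-Adjacent (suc h) h straddles
  where
  straddles : Straddles h (h + suc h) (suc h) h
  straddles = sym (+-suc h h) , ≤-refl , ≤-refl
  members : ∀ v → v ∈ zigzag (suc h) h ⇔ (1 ≤ v × v < h + suc h)
  members v = mk⇔ (bounds ∘ ∈-zigzag⁻ (suc h) h) (∈-zigzag⁺ (suc h) h ∘ sides)
    where
    bounds : (1 ≤ v × v ≤ h) ⊎ (suc h ≤ v × v < suc h + h) → 1 ≤ v × v < h + suc h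
    bounds (inj₁ (1≤v , v≤h))   = 1≤v , ≤-<-trans v≤h (m<m+n h z<s)
    bounds (inj₂ (h<v , v<2h+1)) = ≤-trans z<s h<v , subst (v <_) (sym (+-suc h h)) v<2h+1
    sides : 1 ≤ v × v < h + suc h → (1 ≤ v × v ≤ h) ⊎ (suc h ≤ v × v < suc h + h)
    sides (1≤v , v<2h+1) with v ≤? h
    ... | yes v≤h = inj₁ (1≤v , v≤h)
    ... | no  v≰h = inj₂ (≰⇒> v≰h , subst (v <_) (+-suc h h) v<2h+1)

even-StepPath : ∀ g → StepPath (suc g) (suc g + suc g) (suc g ∷ zigzag (suc (suc g)) g)
even-StepPath g =
  (tabulate (middle∉ ∘ ∈-zigzag⁻ (suc (suc g)) g) ∷ zigzag-unique (suc (suc g)) g (m<n⇒m<1+n ≤-refl)) ,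
  members ,
  λ _ _ → mk⇔ adjacent⇒ adjacent⇐
  where
  n = suc g + suc g
  Z = zigzag (suc (suc g)) g
  straddles : Straddles (suc g) n (suc (suc g)) g
  straddles = cong suc (sym (+-suc g g)) , n≤1+n g , ≤-refl
  middle-Step : Step (suc g) n (suc g) (suc (suc g))
  middle-Step = inj₁ (≤-refl , cong suc (+-suc g (suc g)))
  middle∉ : ∀ {v} → (1 ≤ v × v ≤ g) ⊎ (suc (suc g) ≤ v × v < suc (suc g) + g) → suc g ≢ v
  middle∉ (inj₁ (_ , v≤g)) refl = <-irrefl refl v≤g
  middle∉ (inj₂ (g+1<v , _)) refl = <-irrefl refl g+1<v
  members : ∀ v → v ∈ suc g ∷ Z ⇔ (1 ≤ v × v < n)
  members v = mk⇔ bounds sides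
    where
    bounds : v ∈ suc g ∷ Z → 1 ≤ v × v < n
    bounds (here refl) = z<s , m<m+n (suc g) z<s
    bounds (there v∈Z) with ∈-zigzag⁻ (suc (suc g)) g v∈Z
    ... | inj₁ (1≤v , v≤g)       = 1≤v , s≤s (≤-trans v≤g (m≤m+n g (suc g)))
    ... | inj₂ (g+1<v , v<2g+2) = ≤-trans z<s g+1<v , subst (v <_) (cong suc (sym (+-suc g g))) v<2g+2
    sides : 1 ≤ v × v < n → v ∈ suc g ∷ Z
    sides (1≤v , v<2g+2) with v ≟ suc g | v ≤? g
    ... | yes refl | _       = here refl
    ... | no  _    | yes v≤g = there (∈-zigzag⁺ (suc (suc g)) g (inj₁ (1≤v , v≤g)))
    ... | no  v≢g+1 | no v≰g =
      there (∈-zigzag⁺ (suc (suc g)) g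
               (inj₂ (≤∧≢⇒< (≰⇒> v≰g) (v≢g+1 ∘ sym) , subst (v <_) (cong suc (+-suc g g)) v<2g+2)))
  adjacent⇒ : ∀ {i j} → Adjacent (suc g ∷ Z) i j → i ∈ suc g ∷ Z × 1 < i × Step (suc g) n i j
  adjacent⇒ (zero , refl , q) with Equivalence.to (at-zigzag-head (suc (suc g)) g) q
  ... | 1≤g , refl = here refl , s≤s 1≤g , middle-Step
  adjacent⇒ (suc k , p , q) with Equivalence.to (zigzag-Adjacent (suc (suc g)) g straddles) (k , p , q)
  ... | i∈Z , 1<i , s = there i∈Z , 1<i , s
  adjacent⇐ : ∀ {i j} → i ∈ suc g ∷ Z × 1 < i × Step (suc g) n i j → Adjacent (suc g ∷ Z) i j
  adjacent⇐ (here refl , s≤s 1≤g , s) =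
    0 , refl , trans (Equivalence.from (at-zigzag-head (suc (suc g)) g) (1≤g , refl))
                     (cong just (Step-functional middle-Step s))
  adjacent⇐ (there i∈Z , 1<i , s) with Equivalence.from (zigzag-Adjacent (suc (suc g)) g straddles) (i∈Z , 1<i , s)
  ... | k , p , q = suc k , p , q

HamiltonianPath : ℕ → List ℕ → Set
HamiltonianPath n vs = Unique vs
  × (∀ v → v ∈ vs ⇔ (1 ≤ v × v ≤ n ∸ 1))
  × (∀ i j → Edge n i j ⇔ Adjacent vs i j)

<⇔≤∸1 : ∀ {v n} → 1 ≤ v → v < n ⇔ v ≤ n ∸ 1
<⇔≤∸1 {n = zero}  1≤v = mk⇔ (λ ()) (λ v≤0 → ⊥-elim (<⇒≱ 1≤v v≤0))
<⇔≤∸1 {n = suc n} _   = mk⇔ ≤-pred s≤s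

StepPath⇒HamiltonianPath : ∀ {n h m vs} → n ≡ h + suc m → ⌈ n /2⌉ ≡ suc m →
  StepPath h (h + suc m) vs → HamiltonianPath n vs
StepPath⇒HamiltonianPath {n} {vs = vs} refl ⌈n/2⌉≡ (unique , members , adjacent) =
  unique , members′ , λ i j → ⇔-trans (Edge⇔Step refl ⌈n/2⌉≡) (⇔-trans step⇔∈ (⇔-sym (adjacent i j)))
  where
  members′ : ∀ v → v ∈ vs ⇔ (1 ≤ v × v ≤ n ∸ 1)
  members′ v = ⇔-trans (members v) (mk⇔ (λ (1≤v , v<n) → 1≤v , Equivalence.to (<⇔≤∸1 1≤v) v<n)
                                         (λ (1≤v , v≤) → 1≤v , Equivalence.from (<⇔≤∸1 1≤v) v≤))
  step⇔∈ : ∀ {i} {S : Set} → (1 < i × i < n × S) ⇔ (i ∈ vs × 1 < i × S)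
  step⇔∈ {i} = mk⇔ (λ (1<i , i<n , s) → Equivalence.from (members i) (<⇒≤ 1<i , i<n) , 1<i , s)
                   (λ (i∈ , 1<i , s) → 1<i , proj₂ (Equivalence.to (members i) i∈) , s)

⌈n/2⌉≡⌊n/2⌋⊎1+⌊n/2⌋ : ∀ n → ⌈ n /2⌉ ≡ ⌊ n /2⌋ ⊎ ⌈ n /2⌉ ≡ suc ⌊ n /2⌋
⌈n/2⌉≡⌊n/2⌋⊎1+⌊n/2⌋ zero          = inj₁ refl
⌈n/2⌉≡⌊n/2⌋⊎1+⌊n/2⌋ (suc zero)    = inj₂ refl
⌈n/2⌉≡⌊n/2⌋⊎1+⌊n/2⌋ (suc (suc n)) = Sum.map (cong suc) (cong suc) (⌈n/2⌉≡⌊n/2⌋⊎1+⌊n/2⌋ n)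

lemma3p3 : (n : ℕ) → 1 ≤ n →
    ∃[ vs ] (Unique vs
    × (∀ v → (v ∈ vs) ⇔ ((1 ≤ v) × (v ≤ n ∸ 1)))
    × (∀ i j → Edge n i j ⇔ (∃[ k ] ((at vs k ≡ just i) × (at vs (suc k) ≡ just j)))))
lemma3p3 n 1≤n with ⌊ n /2⌋ | ⌊n/2⌋+⌈n/2⌉≡n n | ⌈n/2⌉≡⌊n/2⌋⊎1+⌊n/2⌋ n
... | h     | h+⌈n/2⌉≡n | inj₂ ⌈n/2⌉≡1+h =
  zigzag (suc h) h ,
  StepPath⇒HamiltonianPath (trans (sym h+⌈n/2⌉≡n) (cong (h +_) ⌈n/2⌉≡1+h)) ⌈n/2⌉≡1+h (odd-StepPath h)
... | zero  | h+⌈n/2⌉≡n | inj₁ ⌈n/2⌉≡h =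
  ⊥-elim (<⇒≱ 1≤n (≤-reflexive (trans (sym h+⌈n/2⌉≡n) ⌈n/2⌉≡h)))
... | suc g | h+⌈n/2⌉≡n | inj₁ ⌈n/2⌉≡h =
  suc g ∷ zigzag (suc (suc g)) g ,
  StepPath⇒HamiltonianPath (trans (sym h+⌈n/2⌉≡n) (cong (suc g +_) ⌈n/2⌉≡h)) ⌈n/2⌉≡h (even-StepPath g)
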